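{- Let $n$ be a positive integer, $C_n=\prod_{k=1}^n(k^3+1)$, and $p$ a prime. Then $$\mathrm{ord}_p(C_n)\leq \sum_{1\leq j\leq \frac{\log(n^3+1)}{\log p}}\left\lceil \frac{n}{p^j}\right\rceil \quad\text{if } p\equiv 2\pmod 3,$$ and $$\mathrm{ord}_p(C_n)\leq 3\sum_{1\leq j\leq \frac{\log(n^3+1)}{\log p}}\left\lceil \frac{n}{p^j}\right\rceil \quad\text{if } p\not\equiv 2\pmod 3,$$ where the sums range over integers $j$.
   Context: For a prime $p$ and a positive integer $m$, $\mathrm{ord}_p(m)$ denotes the exponent of $p$ in the prime factorization of $m$. $\lceil x\rceil$ denotes the least integer greater than or equal to $x$. -}

module Defs where

open import Data.Nat using (ℕ; zero; suc; _+_; _*_; _^_; _≤_; _/_)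
open import Data.Nat.Divisibility using (_∣_)
open import Data.Nat.Properties using (_≤?_)
open import Data.List using (List; map; filter)
open import Data.Nat.ListAction using (sum)
open import Data.List.Base using (upTo)
open import Data.Product using (_×_)
open import Relation.Nullary using (¬_)

C : ℕ → ℕ
C zero = 1
C (suc n) = C n * (suc n ^ 3 + 1)

IsOrd : ℕ → ℕ → ℕ → Set
IsOrd p m e = (p ^ e ∣ m) × ¬ (p ^ suc e ∣ m)

-- ⌈ a / b ⌉ for b ≥ 1 (junk value 0 for b = 0, never used since p ≥ 2)
ceilDiv : ℕ → ℕ → ℕ
ceilDiv a zero = 0
ceilDiv a (suc k) = (a + k) / suc k

-- For p ≥ 2, j ≤ log(n^3+1)/log p ⟺ p^j ≤ n^3+1, and such j satisfy j ≤ n^3+1,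
-- so we range j over 1 .. n^3+1 and keep those with p^j ≤ n^3+1.
bound : ℕ → ℕ → ℕ
bound p n =
  sum (map (λ j → ceilDiv n (p ^ j))
           (filter (λ j → p ^ j ≤? n ^ 3 + 1)
                   (map suc (upTo (n ^ 3 + 1)))))

module Submission where

-- Since ord_p(C_n) = Σ_k ord_p(k³ + 1) and ord_p(m) = #{j ≥ 1 | p^j ∣ m}, we get
-- ord_p(C_n) ≤ Σ_j #{k ≤ n | p^j ∣ k³ + 1} (module Valuation).  It then suffices
-- that every window of p^j consecutive integers contains at most c roots of
-- x³ ≡ -1 (mod p^j) ("(c, p^j)-sparseness"), for then the roots in [1, n] number
-- at most c·⌈n/p^j⌉ (module Counting).  The window bound comes from the
-- structure of the cube roots of -1 (module CubeRoots, computing in ℤ):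
--   * p ≡ 2 (mod 3): all roots are congruent modulo p^j (Fermat's little theorem,
--     proved in module Fermat from the binomial theorem, then Hensel-type lifting);
--   * p ≠ 3: there are no four pairwise incongruent roots modulo p^j;
--   * p = 3: roots modulo 3^(j+1) are ≡ -1 modulo 3^j, hence spaced 3^j apart.

module Fermat where

  open import Data.Nat
  open import Data.Nat.Properties
  open import Data.Nat.Divisibility
  open import Data.Nat.Primality
  open import Data.Nat.Combinatorics
  open import Data.Nat.Tactic.RingSolver using (solve-∀)
  open import Data.Fin using (Fin; toℕ; fromℕ) renaming (zero to fzero; suc to fsuc)
  open import Data.Fin.Properties using (toℕ-fromℕ)
  import Data.Vec.Functional as Vector
  open import Data.Product using (∃-syntax; _,_; proj₁; proj₂)
  open import Data.Sum using (inj₁; inj₂)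
  open import Data.Empty using (⊥-elim)
  open import Function using (_∘_)
  open import Relation.Binary.PropositionalEquality
  open import Algebra.Bundles using (CommutativeSemiring)
  import Algebra.Properties.CommutativeSemiring.Binomial as Binomial
  import Algebra.Properties.Semiring.Mult as Mult
  import Algebra.Properties.Semiring.Exp as Exp

  -- The binomial theorem of the library is stated for an abstract semiring;
  -- over ℕ its scalar multiple and power agree with _*_ and _^_.
  module ℕ-Binomial = Binomial +-*-commutativeSemiring
  module ℕ-Mult = Mult (CommutativeSemiring.semiring +-*-commutativeSemiring)
  module ℕ-Exp = Exp (CommutativeSemiring.semiring +-*-commutativeSemiring)

  ×≡* : ∀ c z → c ℕ-Mult.× z ≡ c * z
  ×≡* zero    z = refl
  ×≡* (suc c) z = cong (z +_) (×≡* c z)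

  ^-agrees : ∀ x n → x ℕ-Exp.^ n ≡ x ^ n
  ^-agrees x zero    = refl
  ^-agrees x (suc n) = cong (x *_) (^-agrees x n)

  absorption : ∀ n k → suc k * (suc n C suc k) ≡ suc n * (n C k)
  absorption zero zero = refl
  absorption zero (suc k) = begin
    suc (suc k) * (1 C suc (suc k)) ≡⟨ cong (suc (suc k) *_) (k>n⇒nCk≡0 {1} {suc (suc k)} (s≤s (s≤s z≤n))) ⟩
    suc (suc k) * 0                 ≡⟨ *-zeroʳ (suc (suc k)) ⟩
    0                               ≡⟨ cong (1 *_) (k>n⇒nCk≡0 {0} {suc k} (s≤s z≤n)) ⟨
    1 * (0 C suc k)                 ∎
    where open ≡-Reasoning
  absorption (suc n) zero = begin
    1 * (suc (suc n) C 1) ≡⟨ *-identityˡ _ ⟩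
    suc (suc n) C 1       ≡⟨ nC1≡n (suc (suc n)) ⟩
    suc (suc n)           ≡⟨ *-identityʳ (suc (suc n)) ⟨
    suc (suc n) * 1       ∎
    where open ≡-Reasoning
  absorption (suc n) (suc k) = begin
    suc (suc k) * (suc (suc n) C suc (suc k))
      ≡⟨ cong (suc (suc k) *_) (nCk+nC[k+1]≡[n+1]C[k+1] (suc n) (suc k)) ⟨
    suc (suc k) * (A + B)
      ≡⟨ regroup k A B ⟩
    (suc k * A + A) + suc (suc k) * B
      ≡⟨ cong₂ (λ u v → (u + A) + v) (absorption n k) (absorption n (suc k)) ⟩
    (suc n * (n C k) + A) + suc n * (n C suc k)
      ≡⟨ regroup′ n (n C k) (n C suc k) A ⟩
    suc n * ((n C k) + (n C suc k)) + A
      ≡⟨ cong (λ u → suc n * u + A) (nCk+nC[k+1]≡[n+1]C[k+1] n k) ⟩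
    suc n * A + A
      ≡⟨ +-comm (suc n * A) A ⟩
    suc (suc n) * A ∎
    where
    open ≡-Reasoning
    A = suc n C suc k
    B = suc n C suc (suc k)
    regroup : ∀ k A B → suc (suc k) * (A + B) ≡ (suc k * A + A) + suc (suc k) * B
    regroup = solve-∀
    regroup′ : ∀ n a b A → (suc n * a + A) + suc n * b ≡ suc n * (a + b) + A
    regroup′ = solve-∀

  prime∣binomial : ∀ {p} → Prime p → ∀ {k} → 0 < k → k < p → p ∣ p C k
  prime∣binomial {suc n} pr {suc k} _ (s≤s k≤n)
    with euclidsLemma (suc k) (suc n C suc k) pr
           (divides (n C k) (trans (absorption n k) (*-comm (suc n) (n C k))))
  ... | inj₂ p∣C = p∣C
  ... | inj₁ p∣k+1 = ⊥-elim (<⇒≱ (s≤s k≤n) (∣⇒≤ p∣k+1))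

  sum≡last+multiple : ∀ {d} m (f : Fin (suc m) → ℕ) → (∀ i → toℕ i < m → d ∣ f i) →
    ∃[ s ] Vector.foldr _+_ 0 f ≡ f (fromℕ m) + s * d
  sum≡last+multiple zero f _ = 0 , refl
  sum≡last+multiple {d} (suc m) f inner
    with inner fzero (s≤s z≤n) | sum≡last+multiple m (f ∘ fsuc) (λ i i<m → inner (fsuc i) (s≤s i<m))
  ... | divides q f₀≡q*d | s , rest = q + s , (begin
    f fzero + Vector.foldr _+_ 0 (f ∘ fsuc) ≡⟨ cong₂ _+_ f₀≡q*d rest ⟩
    q * d + (f (fsuc (fromℕ m)) + s * d)     ≡⟨ regroup q d (f (fsuc (fromℕ m))) s ⟩
    f (fsuc (fromℕ m)) + (q + s) * d         ∎)
    where
    open ≡-Reasoning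
    regroup : ∀ q d F s → q * d + (F + s * d) ≡ F + (q + s) * d
    regroup = solve-∀

  -- (a+1)^p = a^p + 1 + t·p: in the binomial expansion of (a+1)^p the first
  -- term is 1, the last a^p, and all others are multiples of p.
  binomial-mod-p : ∀ {p} → Prime p → ∀ a → ∃[ t ] suc a ^ p ≡ suc (a ^ p + t * p)
  binomial-mod-p {suc m} pr a = t , (begin
    suc a ^ suc m                                 ≡⟨ cong (_^ suc m) (+-comm 1 a) ⟩
    (a + 1) ^ suc m                               ≡⟨ ^-agrees (a + 1) (suc m) ⟨
    (a + 1) ℕ-Exp.^ suc m                         ≡⟨ ℕ-Binomial.theorem (suc m) a 1 ⟩
    term fzero + Vector.foldr _+_ 0 (term ∘ fsuc) ≡⟨ cong₂ _+_ first middle ⟩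
    1 + (term (fsuc (fromℕ m)) + t * suc m)       ≡⟨ cong (λ u → suc (u + t * suc m)) last ⟩
    suc (a ^ suc m + t * suc m)                   ∎)
    where
    open ≡-Reasoning
    term = ℕ-Binomial.binomialTerm a 1 (suc m)
    inner : ∀ i → toℕ i < m → suc m ∣ term (fsuc i)
    inner i i<m = subst (suc m ∣_) (sym (×≡* (suc m C suc (toℕ i)) _))
      (∣m⇒∣m*n _ (prime∣binomial pr (s≤s z≤n) (s≤s i<m)))
    t = proj₁ (sum≡last+multiple m (term ∘ fsuc) inner)
    middle = proj₂ (sum≡last+multiple m (term ∘ fsuc) inner)
    first : term fzero ≡ 1
    first = begin
      1 ℕ-Mult.× (1 * 1 ℕ-Exp.^ suc m) ≡⟨ ×≡* 1 _ ⟩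
      1 * (1 * 1 ℕ-Exp.^ suc m)       ≡⟨ trans (*-identityˡ _) (*-identityˡ _) ⟩
      1 ℕ-Exp.^ suc m                 ≡⟨ trans (^-agrees 1 (suc m)) (^-zeroˡ (suc m)) ⟩
      1                               ∎
    top : ∀ j → j ≡ suc m → (suc m C j) ℕ-Mult.× (a ℕ-Exp.^ j * 1 ℕ-Exp.^ (suc m ∸ j)) ≡ a ^ suc m
    top .(suc m) refl = begin
      (suc m C suc m) ℕ-Mult.× (a ℕ-Exp.^ suc m * 1 ℕ-Exp.^ (m ∸ m))
        ≡⟨ ×≡* (suc m C suc m) _ ⟩
      (suc m C suc m) * (a ℕ-Exp.^ suc m * 1 ℕ-Exp.^ (m ∸ m))
        ≡⟨ cong₂ (λ c e → c * (a ℕ-Exp.^ suc m * 1 ℕ-Exp.^ e)) (nCn≡1 (suc m)) (n∸n≡0 m) ⟩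
      1 * (a ℕ-Exp.^ suc m * 1)
        ≡⟨ trans (*-identityˡ _) (*-identityʳ _) ⟩
      a ℕ-Exp.^ suc m
        ≡⟨ ^-agrees a (suc m) ⟩
      a ^ suc m ∎
    last : term (fsuc (fromℕ m)) ≡ a ^ suc m
    last = top (toℕ (fsuc (fromℕ m))) (cong suc (toℕ-fromℕ m))

  fermat : ∀ {p} → Prime p → ∀ a → ∃[ s ] a ^ p ≡ a + s * p
  fermat {suc m} pr zero = 0 , refl
  fermat {p} pr (suc a) with fermat pr a | binomial-mod-p pr a
  ... | s , aᵖ≡ | t , sucaᵖ≡ = s + t , (begin
    suc a ^ p                 ≡⟨ sucaᵖ≡ ⟩
    suc (a ^ p + t * p)       ≡⟨ cong (λ u → suc (u + t * p)) aᵖ≡ ⟩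
    suc (a + s * p + t * p)   ≡⟨ cong suc (+-assoc a (s * p) (t * p)) ⟩
    suc (a + (s * p + t * p)) ≡⟨ cong (λ u → suc (a + u)) (*-distribʳ-+ p s t) ⟨
    suc a + (s + t) * p       ∎)
    where open ≡-Reasoning

module PrimePowers where

  open import Data.Nat
  open import Data.Nat.Properties
  open import Data.Nat.Divisibility
  open import Data.Nat.Primality
  open import Data.Nat.Tactic.RingSolver using (solve-∀)
  open import Data.Product using (∃₂; _×_; _,_)
  open import Data.Sum using (inj₁; inj₂)
  open import Data.Empty using (⊥-elim)
  open import Relation.Nullary using (¬_)
  open import Relation.Binary.PropositionalEquality

  prime>1 : ∀ {p} → Prime p → 1 < p
  prime>1 {p} pr = nonTrivial⇒n>1 p {{prime⇒nonTrivial pr}}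

  cancel-p : ∀ {p} → Prime p → ∀ {m n} → p * m ∣ p * n → m ∣ n
  cancel-p {p} pr = *-cancelˡ-∣ p {{prime⇒nonZero pr}}

  ^-suc-∣ : ∀ p {e n} → p ^ e ∣ n → p ^ suc e ∣ n * p
  ^-suc-∣ p {e} {n} d = subst (_∣ n * p) (*-comm (p ^ e) p) (*-monoˡ-∣ p d)

  split-power : ∀ {p} → Prime p → ∀ e a b → p ^ e ∣ a * b →
    ∃₂ λ e₁ e₂ → p ^ e₁ ∣ a × p ^ e₂ ∣ b × e ≤ e₁ + e₂
  split-power pr zero a b _ = 0 , 0 , 1∣ a , 1∣ b , z≤n
  split-power {p} pr (suc e) a b pᵉ⁺¹∣ab
    with euclidsLemma a b pr (∣-trans (m∣m*n (p ^ e)) pᵉ⁺¹∣ab)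
  ... | inj₁ (divides a′ refl)
    with split-power pr e a′ b (cancel-p pr (subst (p * p ^ e ∣_) (shuffle a′ p b) pᵉ⁺¹∣ab))
    where
    shuffle : ∀ a′ p b → a′ * p * b ≡ p * (a′ * b)
    shuffle a′ p b = trans (*-assoc a′ p b) (trans (cong (a′ *_) (*-comm p b))
                     (trans (sym (*-assoc a′ b p)) (*-comm (a′ * b) p)))
  ... | e₁ , e₂ , d₁ , d₂ , e≤ = suc e₁ , e₂ , ^-suc-∣ p {e₁} d₁ , d₂ , s≤s e≤
  split-power {p} pr (suc e) a b pᵉ⁺¹∣ab | inj₂ (divides b′ refl)
    with split-power pr e a b′ (cancel-p pr (subst (p * p ^ e ∣_) (shuffle a b′ p) pᵉ⁺¹∣ab))
    where
    shuffle : ∀ a b′ p → a * (b′ * p) ≡ p * (a * b′)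
    shuffle a b′ p = trans (sym (*-assoc a b′ p)) (*-comm (a * b′) p)
  ... | e₁ , e₂ , d₁ , d₂ , e≤ = e₁ , suc e₂ , d₁ , ^-suc-∣ p {e₂} d₂ , ≤-trans (s≤s e≤) (≤-reflexive (sym (+-suc e₁ e₂)))

  ^-mono-∣ : ∀ p {x y} → x ≤ y → p ^ x ∣ p ^ y
  ^-mono-∣ p {x} {y} x≤y = divides (p ^ (y ∸ x)) (begin
    p ^ y                 ≡⟨ cong (p ^_) (m+[n∸m]≡n x≤y) ⟨
    p ^ (x + (y ∸ x))     ≡⟨ ^-distribˡ-+-* p x (y ∸ x) ⟩
    p ^ x * p ^ (y ∸ x)   ≡⟨ *-comm (p ^ x) _ ⟩
    p ^ (y ∸ x) * p ^ x   ∎)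
    where open ≡-Reasoning

  cancel-power : ∀ {p} → Prime p → ∀ d {a g} → p ^ d ∣ a * g → ¬ p ∣ g → p ^ d ∣ a
  cancel-power {p} pr d {a} {g} pᵈ∣ag p∤g with split-power pr d a g pᵈ∣ag
  ... | e₁ , zero , d₁ , _ , d≤e₁+0 = ∣-trans (^-mono-∣ p (≤-trans d≤e₁+0 (≤-reflexive (+-identityʳ e₁)))) d₁
  ... | _ , suc e₂ , _ , d₂ , _ = ⊥-elim (p∤g (∣-trans (m∣m*n (p ^ e₂)) d₂))

module CubeRoots where

  open import Data.Nat as ℕ using (ℕ; zero; suc)
  import Data.Nat.Properties as ℕ
  import Data.Nat.DivMod as ℕ
  import Data.Nat.Divisibility as ℕ
  open import Data.Nat.Primality using (Prime; prime?; prime⇒irreducible; euclidsLemma)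
  open import Data.Integer using (ℤ; 0ℤ; +_; -_; _+_; _-_; _*_; _^_; 1ℤ) renaming (∣_∣ to abs)
  open import Data.Integer.Properties using (abs-*; pos-*; pos-+; +-inverseʳ; ^-distribˡ-+-*; ^-*-assoc)
  open import Data.Integer.Divisibility.Signed
  open import Data.Integer.Tactic.RingSolver using (solve-∀)
  open import Data.Product using (proj₁; proj₂)
  open import Data.Sum as Sum using (_⊎_; [_,_]′)
  open import Data.Empty using (⊥; ⊥-elim)
  open import Relation.Nullary using (¬_)
  open import Relation.Nullary.Decidable using (from-yes; decidable-stable)
  open import Relation.Binary.PropositionalEquality
  open Fermat using (fermat)
  open PrimePowers using (prime>1; cancel-power)

  ℤ-euclid : ∀ {p} → Prime p → ∀ X Y → + p ∣ X * Y → + p ∣ X ⊎ + p ∣ Y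
  ℤ-euclid pr X Y p∣XY =
    Sum.map ∣ᵤ⇒∣ ∣ᵤ⇒∣ (euclidsLemma (abs X) (abs Y) pr (subst (_ ℕ.∣_) (abs-* X Y) (∣⇒∣ᵤ p∣XY)))

  ℤ-cancel-power : ∀ {p} → Prime p → ∀ d X G → + (p ℕ.^ d) ∣ X * G → ¬ + p ∣ G → + (p ℕ.^ d) ∣ X
  ℤ-cancel-power pr d X G pᵈ∣XG p∤G =
    ∣ᵤ⇒∣ (cancel-power pr d (subst (_ ℕ.∣_) (abs-* X G) (∣⇒∣ᵤ pᵈ∣XG)) (λ p∣G → p∤G (∣ᵤ⇒∣ p∣G)))

  prime∤1 : ∀ {p} → Prime p → ¬ + p ∣ 1ℤ
  prime∤1 pr p∣1 = ℕ.<⇒≢ (prime>1 pr) (sym (ℕ.∣1⇒≡1 (∣⇒∣ᵤ p∣1)))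

  ∣-combination : ∀ {P A B C} → P ∣ A → P ∣ B → ∀ U V → U * A + V * B ≡ C → P ∣ C
  ∣-combination P∣A P∣B U V eq = subst (_ ∣_) eq (∣m∣n⇒∣m+n (∣n⇒∣m*n U P∣A) (∣n⇒∣m*n V P∣B))

  root-coprime : ∀ {p} → Prime p → ∀ {Q} X → + p ∣ Q → Q ∣ X * X * X + 1ℤ → ¬ + p ∣ X
  root-coprime pr X p∣Q Q∣root p∣X =
    prime∤1 pr (∣-combination (∣-trans p∣Q Q∣root) p∣X 1ℤ (- (X * X)) (identity X))
    where
    identity : ∀ X → 1ℤ * (X * X * X + 1ℤ) + - (X * X) * X ≡ 1ℤ
    identity = solve-∀

  prime[3] : Prime 3
  prime[3] = from-yes (prime? 3)

  -- Φ(X,Y) = X² + XY + Y², the cofactor in X³ - Y³ = (X - Y)·Φ(X,Y).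
  Φ : ℤ → ℤ → ℤ
  Φ X Y = X * X + X * Y + Y * Y

  -- Modulo p, X ≡ Y gives Φ(X,Y) ≡ 3X²; so for p ≠ 3 and p ∤ X, p ∤ Φ(X,Y).
  Φ-coprime : ∀ {p} → Prime p → p ≢ 3 → ∀ X Y → + p ∣ X - Y → ¬ + p ∣ X → ¬ + p ∣ Φ X Y
  Φ-coprime {p} pr p≢3 X Y p∣X-Y p∤X p∣Φ =
    [ p∤3 , (λ p∣X² → [ p∤X , p∤X ]′ (ℤ-euclid pr X X p∣X²)) ]′ (ℤ-euclid pr (+ 3) (X * X) p∣3X²)
    where
    identity : ∀ X Y → 1ℤ * (X * X + X * Y + Y * Y) + (Y + + 2 * X) * (X - Y) ≡ + 3 * (X * X)
    identity = solve-∀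
    p∣3X² : + p ∣ + 3 * (X * X)
    p∣3X² = ∣-combination p∣Φ p∣X-Y 1ℤ (Y + + 2 * X) (identity X Y)
    p∤3 : ¬ + p ∣ + 3
    p∤3 p∣3 = [ (λ p≡1 → ℕ.<⇒≢ (prime>1 pr) (sym p≡1)) , p≢3 ]′ (prime⇒irreducible prime[3] (∣⇒∣ᵤ p∣3))

  lift-congruence : ∀ {p} → Prime p → ∀ j X Y →
    + (p ℕ.^ j) ∣ X * X * X + 1ℤ → + (p ℕ.^ j) ∣ Y * Y * Y + 1ℤ → ¬ + p ∣ Φ X Y →
    + (p ℕ.^ j) ∣ X - Y
  lift-congruence pr j X Y rootX rootY p∤Φ =
    ℤ-cancel-power pr j (X - Y) (Φ X Y) (∣-combination rootX rootY 1ℤ (- 1ℤ) (identity X Y)) p∤Φ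
    where
    identity : ∀ X Y → 1ℤ * (X * X * X + 1ℤ) + - 1ℤ * (Y * Y * Y + 1ℤ) ≡ (X - Y) * (X * X + X * Y + Y * Y)
    identity = solve-∀

  p∣p^suc : ∀ p j → + p ∣ + (p ℕ.^ suc j)
  p∣p^suc p j = ∣ᵤ⇒∣ (ℕ.m∣m*n (p ℕ.^ j))

  p^0∣ : ∀ p X → + (p ℕ.^ 0) ∣ X
  p^0∣ p X = ∣ᵤ⇒∣ (ℕ.1∣ abs X)

  pos-^ : ∀ x n → + (x ℕ.^ n) ≡ (+ x) ^ n
  pos-^ x zero    = refl
  pos-^ x (suc n) = trans (pos-* x (x ℕ.^ n)) (cong (+ x *_) (pos-^ x n))

  fermat-ℤ : ∀ {p} → Prime p → ∀ x → + p ∣ (+ x) ^ p - + x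
  fermat-ℤ {p} pr x = divides (+ s) (begin
    (+ x) ^ p - + x         ≡⟨ cong (_- + x) (pos-^ x p) ⟨
    + (x ℕ.^ p) - + x       ≡⟨ cong (λ u → + u - + x) xᵖ≡x+sp ⟩
    + (x ℕ.+ s ℕ.* p) - + x ≡⟨ cong (_- + x) (trans (pos-+ x (s ℕ.* p)) (cong (λ u → + x + u) (pos-* s p))) ⟩
    + x + + s * + p - + x   ≡⟨ cancel (+ x) (+ s * + p) ⟩
    + s * + p               ∎)
    where
    open ≡-Reasoning
    s = proj₁ (fermat pr x)
    xᵖ≡x+sp : x ℕ.^ p ≡ x ℕ.+ s ℕ.* p
    xᵖ≡x+sp = proj₂ (fermat pr x)
    cancel : ∀ X Z → X + Z - X ≡ Z
    cancel = solve-∀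

  ^-congruence : ∀ {P A B} → P ∣ A - B → ∀ m → P ∣ A ^ m - B ^ m
  ^-congruence {P} P∣A-B zero = divides 0ℤ (+-inverseʳ 1ℤ)
  ^-congruence {P} {A} {B} P∣A-B (suc m) =
    ∣-combination (^-congruence P∣A-B m) P∣A-B A (B ^ m) (identity A B (A ^ m) (B ^ m))
    where
    identity : ∀ A B a b → A * (a - b) + b * (A - B) ≡ A * a - B * b
    identity = solve-∀

  -- For p = 3m + 2, Fermat gives x ≡ x^p = x²·(x³)^m ≡ (-1)^m·x² (mod p) at a root x of x³ ≡ -1.
  root-mod-p : ∀ {p} → Prime p → p ℕ.% 3 ≡ 2 → ∀ x → let X = + x in
    + p ∣ X * X * X + 1ℤ → + p ∣ X - (- 1ℤ) ^ (p ℕ./ 3) * (X * X)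
  root-mod-p {p} pr p%3≡2 x root =
    ∣-combination fermat′ (^-congruence cube≡-1 m) (- 1ℤ) (X * X) (identity X ((X ^ 3) ^ m) ((- 1ℤ) ^ m))
    where
    X = + x
    m = p ℕ./ 3
    p≡2+3m : p ≡ 2 ℕ.+ 3 ℕ.* m
    p≡2+3m = trans (ℕ.m≡m%n+[m/n]*n p 3) (cong₂ ℕ._+_ p%3≡2 (ℕ.*-comm m 3))
    Xᵖ≡ : X ^ p ≡ X ^ 2 * (X ^ 3) ^ m
    Xᵖ≡ = trans (cong (X ^_) p≡2+3m) (trans (^-distribˡ-+-* X 2 (3 ℕ.* m)) (cong (X ^ 2 *_) (sym (^-*-assoc X 3 m))))
    fermat′ : + p ∣ X ^ 2 * (X ^ 3) ^ m - X
    fermat′ = subst (λ u → + p ∣ u - X) Xᵖ≡ (fermat-ℤ pr x)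
    cube≡-1 : + p ∣ X ^ 3 - - 1ℤ
    cube≡-1 = subst (+ p ∣_) (shape X) root
      where
      shape : ∀ X → X * X * X + 1ℤ ≡ X * (X * (X * 1ℤ)) - - 1ℤ
      shape = solve-∀
    identity : ∀ X C ε → - 1ℤ * (X * (X * 1ℤ) * C - X) + X * X * (C - ε) ≡ X - ε * (X * X)
    identity = solve-∀

  roots-congruent-mod-p : ∀ {p} → Prime p → p ℕ.% 3 ≡ 2 → ∀ x y → let X = + x; Y = + y in
    + p ∣ X * X * X + 1ℤ → + p ∣ Y * Y * Y + 1ℤ → + p ∣ X - Y
  roots-congruent-mod-p {p} pr p%3≡2 x y rootX rootY =
    [ (λ p∣XY → ⊥-elim ([ root-coprime pr X ∣-refl rootX , root-coprime pr Y ∣-refl rootY ]′ (ℤ-euclid pr X Y p∣XY)))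
    , (λ p∣X-Y → p∣X-Y) ]′ (ℤ-euclid pr (X * Y) (X - Y) p∣XY[X-Y])
    where
    X = + x
    Y = + y
    identity : ∀ X Y ε → - (Y * Y) * (X - ε * (X * X)) + X * X * (Y - ε * (Y * Y)) ≡ X * Y * (X - Y)
    identity = solve-∀
    p∣XY[X-Y] : + p ∣ X * Y * (X - Y)
    p∣XY[X-Y] = ∣-combination (root-mod-p pr p%3≡2 x rootX) (root-mod-p pr p%3≡2 y rootY)
                  (- (Y * Y)) (X * X) (identity X Y ((- 1ℤ) ^ (p ℕ./ 3)))

  roots-congruent : ∀ {p} → Prime p → p ℕ.% 3 ≡ 2 → ∀ j x y → let X = + x; Y = + y in
    + (p ℕ.^ j) ∣ X * X * X + 1ℤ → + (p ℕ.^ j) ∣ Y * Y * Y + 1ℤ → + (p ℕ.^ j) ∣ X - Y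
  roots-congruent {p} pr p%3≡2 zero    x y _ _ = p^0∣ p (+ x - + y)
  roots-congruent {p} pr p%3≡2 (suc j) x y rootX rootY =
    lift-congruence pr (suc j) (+ x) (+ y) rootX rootY
      (Φ-coprime pr p≢3 (+ x) (+ y)
         (roots-congruent-mod-p pr p%3≡2 x y (∣-trans p∣Q rootX) (∣-trans p∣Q rootY))
         (root-coprime pr (+ x) p∣Q rootX))
    where
    p∣Q = p∣p^suc p j
    p≢3 : p ≢ 3
    p≢3 p≡3 = ℕ.0≢1+n (trans (cong (ℕ._% 3) (sym p≡3)) p%3≡2)

  -- Distinct roots A, B force p ∣ Φ(A,B); for three distinct
  -- roots Φ(A,B) - Φ(A,C) = (B - C)(A + B + C) then forces p ∣ A + B + C, and
  -- two such triples sharing A, B contradict the distinctness of the fourth pair.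
  module _ {p} (pr : Prime p) (p≢3 : p ≢ 3) (j : ℕ) where

    private
      Q : ℤ
      Q = + (p ℕ.^ suc j)

    Φ-obstruction : ∀ B C → Q ∣ B * B * B + 1ℤ → + p ∣ B - C → ¬ + p ∣ Φ B C
    Φ-obstruction B C rootB p∣B-C = Φ-coprime pr p≢3 B C p∣B-C (root-coprime pr B (p∣p^suc p j) rootB)

    distinct-roots⇒p∣Φ : ∀ A B → Q ∣ A * A * A + 1ℤ → Q ∣ B * B * B + 1ℤ → ¬ Q ∣ A - B → + p ∣ Φ A B
    distinct-roots⇒p∣Φ A B rootA rootB A≢B =
      decidable-stable (+ p ∣? Φ A B) (λ p∤Φ → A≢B (lift-congruence pr (suc j) A B rootA rootB p∤Φ))

    three-roots-sum : ∀ A B C → Q ∣ A * A * A + 1ℤ → Q ∣ B * B * B + 1ℤ → Q ∣ C * C * C + 1ℤ →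
      ¬ Q ∣ A - B → ¬ Q ∣ A - C → ¬ Q ∣ B - C → + p ∣ A + B + C
    three-roots-sum A B C rootA rootB rootC A≢B A≢C B≢C =
      [ (λ p∣B-C → ⊥-elim (Φ-obstruction B C rootB p∣B-C (distinct-roots⇒p∣Φ B C rootB rootC B≢C)))
      , (λ p∣sum → p∣sum) ]′ (ℤ-euclid pr (B - C) (A + B + C) p∣[B-C][A+B+C])
      where
      identity : ∀ A B C → 1ℤ * (A * A + A * B + B * B) + - 1ℤ * (A * A + A * C + C * C) ≡ (B - C) * (A + B + C)
      identity = solve-∀
      p∣[B-C][A+B+C] : + p ∣ (B - C) * (A + B + C)
      p∣[B-C][A+B+C] = ∣-combination (distinct-roots⇒p∣Φ A B rootA rootB A≢B) (distinct-roots⇒p∣Φ A C rootA rootC A≢C)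
                         1ℤ (- 1ℤ) (identity A B C)

    no-four-roots : ∀ A B C D →
      Q ∣ A * A * A + 1ℤ → Q ∣ B * B * B + 1ℤ → Q ∣ C * C * C + 1ℤ → Q ∣ D * D * D + 1ℤ →
      ¬ Q ∣ A - B → ¬ Q ∣ A - C → ¬ Q ∣ A - D → ¬ Q ∣ B - C → ¬ Q ∣ B - D → ¬ Q ∣ C - D → ⊥
    no-four-roots A B C D rootA rootB rootC rootD A≢B A≢C A≢D B≢C B≢D C≢D =
      Φ-obstruction C D rootC p∣C-D (distinct-roots⇒p∣Φ C D rootC rootD C≢D)
      where
      identity : ∀ A B C D → 1ℤ * (A + B + C) + - 1ℤ * (A + B + D) ≡ C - D
      identity = solve-∀
      p∣C-D : + p ∣ C - D
      p∣C-D = ∣-combination (three-roots-sum A B C rootA rootB rootC A≢B A≢C B≢C)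
                            (three-roots-sum A B D rootA rootB rootD A≢B A≢D B≢D) 1ℤ (- 1ℤ) (identity A B C D)

  -- For p = 3: a root of x³ ≡ -1 modulo 3^(j+1) satisfies x ≡ -1 modulo 3^j.
  -- Fermat gives 3 ∣ x + 1, say x + 1 = 3u; then x³ + 1 = 3(x + 1)(3(u² - u) + 1)
  -- and the last factor is prime to 3.
  root-mod-3 : ∀ j x → let X = + x in + (3 ℕ.^ suc j) ∣ X * X * X + 1ℤ → + (3 ℕ.^ j) ∣ X + 1ℤ
  root-mod-3 j x root = ℤ-cancel-power prime[3] j (X + 1ℤ) W 3ʲ∣[X+1]W 3∤W
    where
    X = + x
    3∣X+1 : + 3 ∣ X + 1ℤ
    3∣X+1 = ∣-combination (∣-trans (p∣p^suc 3 j) root) (fermat-ℤ prime[3] x) 1ℤ (- 1ℤ) (identity X)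
      where
      identity : ∀ X → 1ℤ * (X * X * X + 1ℤ) + - 1ℤ * (X * (X * (X * 1ℤ)) - X) ≡ X + 1ℤ
      identity = solve-∀
    U : ℤ
    U = quotient 3∣X+1
    W : ℤ
    W = + 3 * (U * U - U) + 1ℤ
    X≡3U-1 : X ≡ U * + 3 - 1ℤ
    X≡3U-1 = trans (sym (identity X)) (cong (_- 1ℤ) (_∣_.equality 3∣X+1))
      where
      identity : ∀ X → X + 1ℤ - 1ℤ ≡ X
      identity = solve-∀
    factorisation : X * X * X + 1ℤ ≡ + 3 * ((X + 1ℤ) * W)
    factorisation = subst (λ Z → Z * Z * Z + 1ℤ ≡ + 3 * ((Z + 1ℤ) * W)) (sym X≡3U-1) (identity U)
      where
      identity : ∀ U → (U * + 3 - 1ℤ) * (U * + 3 - 1ℤ) * (U * + 3 - 1ℤ) + 1ℤ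
                     ≡ + 3 * ((U * + 3 - 1ℤ + 1ℤ) * (+ 3 * (U * U - U) + 1ℤ))
      identity = solve-∀
    3ʲ∣[X+1]W : + (3 ℕ.^ j) ∣ (X + 1ℤ) * W
    3ʲ∣[X+1]W = *-cancelˡ-∣ (+ 3) (subst₂ _∣_ (pos-* 3 (3 ℕ.^ j)) factorisation root)
    3∤W : ¬ + 3 ∣ W
    3∤W 3∣W = prime∤1 prime[3] (∣m+n∣m⇒∣n 3∣W (∣m⇒∣m*n (U * U - U) ∣-refl))

module Counting where

  open import Data.Nat
  open import Data.Nat.Properties
  open import Data.Nat.Divisibility using (_∣_; ∣⇒≤)
  open import Data.Nat.DivMod using (m≡m%n+[m/n]*n; m%n<n)
  open import Data.Product using (_×_; _,_)
  open import Data.Empty using (⊥; ⊥-elim)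
  open import Function using (_∘_)
  open import Relation.Nullary using (¬_; Dec; yes; no)
  open import Relation.Binary.PropositionalEquality
  open import Defs using (ceilDiv)

  indicator : ∀ {A : Set} → Dec A → ℕ
  indicator (yes _) = 1
  indicator (no _)  = 0

  data Chain (P : ℕ → Set) (lo : ℕ) : ℕ → ℕ → Set where
    []   : ∀ {hi} → Chain P lo hi 0
    cons : ∀ {hi len} k → lo ≤ k → k < hi → P k → Chain P lo k len → Chain P lo hi (suc len)

  chain-weaken : ∀ {P lo hi hi′ len} → hi ≤ hi′ → Chain P lo hi len → Chain P lo hi′ len
  chain-weaken hi≤hi′ []                    = []
  chain-weaken hi≤hi′ (cons k lo≤k k<hi Pk ks) = cons k lo≤k (≤-trans k<hi hi≤hi′) Pk ks

  Sparse : (ℕ → Set) → ℕ → ℕ → Set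
  Sparse P c q = ∀ a → ¬ Chain P a (a + q) (suc c)

  sparse-mono : ∀ {P c q q′} → q′ ≤ q → Sparse P c q → Sparse P c q′
  sparse-mono q′≤q sparse a = sparse a ∘ chain-weaken (+-monoʳ-≤ a q′≤q)

  module _ {P : ℕ → Set} (P? : ∀ k → Dec (P k)) where

    count : ℕ → ℕ → ℕ
    count a zero    = 0
    count a (suc m) = count a m + indicator (P? (a + m))

    count-+ : ∀ a m d → count a (m + d) ≡ count a m + count (a + m) d
    count-+ a m zero = trans (cong (count a) (+-identityʳ m)) (sym (+-identityʳ _))
    count-+ a m (suc d) = begin
      count a (m + suc d)                                    ≡⟨ cong (count a) (+-suc m d) ⟩
      count a (m + d) + indicator (P? (a + (m + d)))         ≡⟨ cong₂ _+_ (count-+ a m d) (cong (indicator ∘ P?) (sym (+-assoc a m d))) ⟩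
      count a m + count (a + m) d + indicator (P? (a + m + d)) ≡⟨ +-assoc (count a m) _ _ ⟩
      count a m + count (a + m) (suc d)                      ∎
      where open ≡-Reasoning

    count-mono : ∀ a {m m′} → m ≤ m′ → count a m ≤ count a m′
    count-mono a {m} {m′} m≤m′ = begin
      count a m                          ≤⟨ m≤m+n (count a m) _ ⟩
      count a m + count (a + m) (m′ ∸ m) ≡⟨ count-+ a m (m′ ∸ m) ⟨
      count a (m + (m′ ∸ m))             ≡⟨ cong (count a) (m+[n∸m]≡n m≤m′) ⟩
      count a m′                         ∎
      where open ≤-Reasoning

    count-≤ : ∀ a m c → ¬ Chain P a (a + m) (suc c) → count a m ≤ c
    count-≤ a zero    c _ = z≤n
    count-≤ a (suc m) c noChain with P? (a + m)
    ... | no _ = subst (_≤ c) (sym (+-identityʳ _))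
                   (count-≤ a m c (noChain ∘ chain-weaken (+-monoʳ-≤ a (n≤1+n m))))
    ... | yes Pk with c
    ...   | zero   = ⊥-elim (noChain (cons (a + m) (m≤m+n a m) (+-monoʳ-< a (n<1+n m)) Pk []))
    ...   | suc c′ = subst (_≤ suc c′) (+-comm 1 _)
                       (s≤s (count-≤ a m c′ (noChain ∘ cons (a + m) (m≤m+n a m) (+-monoʳ-< a (n<1+n m)) Pk)))

    count-windows : ∀ {c q} → Sparse P c q → ∀ a t → count a (t * q) ≤ t * c
    count-windows sparse a zero = z≤n
    count-windows {c} {q} sparse a (suc t) = begin
      count a (q + t * q)                 ≡⟨ count-+ a q (t * q) ⟩
      count a q + count (a + q) (t * q)   ≤⟨ +-mono-≤ (count-≤ a q c (sparse a)) (count-windows sparse (a + q) t) ⟩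
      c + t * c                           ∎
      where open ≤-Reasoning

  ≤-ceilDiv : ∀ n k → n ≤ ceilDiv n (suc k) * suc k
  ≤-ceilDiv n k = +-cancelʳ-≤ k n _ (begin
    n + k                                   ≡⟨ m≡m%n+[m/n]*n (n + k) (suc k) ⟩
    (n + k) % suc k + ceilDiv n (suc k) * suc k ≤⟨ +-monoˡ-≤ _ (s≤s⁻¹ (m%n<n (n + k) (suc k))) ⟩
    k + ceilDiv n (suc k) * suc k           ≡⟨ +-comm k _ ⟩
    ceilDiv n (suc k) * suc k + k           ∎)
    where open ≤-Reasoning

  count-sparse : ∀ {P} (P? : ∀ k → Dec (P k)) {c q} → .{{NonZero q}} → Sparse P c q →
    ∀ a n → count P? a n ≤ c * ceilDiv n q
  count-sparse P? {c} {suc k} sparse a n = begin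
    count P? a n                               ≤⟨ count-mono P? a (≤-ceilDiv n k) ⟩
    count P? a (ceilDiv n (suc k) * suc k)     ≤⟨ count-windows P? sparse a (ceilDiv n (suc k)) ⟩
    ceilDiv n (suc k) * c                      ≡⟨ *-comm _ c ⟩
    c * ceilDiv n (suc k)                      ∎
    where open ≤-Reasoning

  gap : ∀ {r x y} → y < x → r ∣ x ∸ y → y + r ≤ x
  gap {r} {x} {y} y<x r∣x-y = begin
    y + r       ≤⟨ +-monoʳ-≤ y (∣⇒≤ {{>-nonZero (m<n⇒0<n∸m y<x)}} r∣x-y) ⟩
    y + (x ∸ y) ≡⟨ m+[n∸m]≡n (<⇒≤ y<x) ⟩
    x           ∎
    where open ≤-Reasoning

  -- If all elements of P are congruent modulo r, they are spaced at least r
  -- apart, so a window of length c·r holds at most c of them.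
  module _ {P : ℕ → Set} {r : ℕ} (congruent : ∀ {x y} → P x → P y → y < x → r ∣ x ∸ y) where

    spread : ∀ {lo k len} → P k → lo ≤ k → Chain P lo k len → lo + len * r ≤ k
    spread {lo} {k} _ lo≤k [] = subst (_≤ k) (sym (+-identityʳ lo)) lo≤k
    spread {lo} {k} {suc len} Pk _ (cons k′ lo≤k′ k′<k Pk′ ks) = begin
      lo + (r + len * r) ≡⟨ trans (cong (lo +_) (+-comm r _)) (sym (+-assoc lo _ r)) ⟩
      lo + len * r + r   ≤⟨ +-monoˡ-≤ r (spread Pk′ lo≤k′ ks) ⟩
      k′ + r             ≤⟨ gap k′<k (congruent Pk Pk′ k′<k) ⟩
      k                  ∎
      where open ≤-Reasoning

    sparse-of-congruent : ∀ c → Sparse P c (c * r)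
    sparse-of-congruent c a (cons k a≤k k<a+cr Pk ks) = <⇒≱ k<a+cr (spread Pk a≤k ks)

  Apart : ℕ → ℕ → ℕ → Set
  Apart q x y = y < x × ¬ q ∣ x ∸ y

  window-apart : ∀ {q a x y} → a ≤ y → y < x → x < a + q → Apart q x y
  window-apart {q} {a} {x} {y} a≤y y<x x<a+q = y<x , λ q∣x-y → <⇒≱ x<a+q (begin
    a + q ≤⟨ +-monoˡ-≤ q a≤y ⟩
    y + q ≤⟨ gap y<x q∣x-y ⟩
    x     ∎)
    where open ≤-Reasoning

  sparse-of-three-classes : ∀ {P q} →
    (∀ {x₁ x₂ x₃ x₄} → P x₁ → P x₂ → P x₃ → P x₄ →
       Apart q x₁ x₂ → Apart q x₁ x₃ → Apart q x₁ x₄ → Apart q x₂ x₃ → Apart q x₂ x₄ → Apart q x₃ x₄ → ⊥) →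
    Sparse P 3 q
  sparse-of-three-classes noFour a
    (cons x₁ _ x₁<top P₁ (cons x₂ a≤x₂ x₂<x₁ P₂ (cons x₃ a≤x₃ x₃<x₂ P₃ (cons x₄ a≤x₄ x₄<x₃ P₄ [])))) =
    noFour P₁ P₂ P₃ P₄
      (window-apart a≤x₂ x₂<x₁ x₁<top) (window-apart a≤x₃ x₃<x₁ x₁<top) (window-apart a≤x₄ x₄<x₁ x₁<top)
      (window-apart a≤x₃ x₃<x₂ x₂<top) (window-apart a≤x₄ x₄<x₂ x₂<top) (window-apart a≤x₄ x₄<x₃ x₃<top)
    where
    x₃<x₁ = <-trans x₃<x₂ x₂<x₁
    x₄<x₂ = <-trans x₄<x₃ x₃<x₂
    x₄<x₁ = <-trans x₄<x₂ x₂<x₁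
    x₂<top = <-trans x₂<x₁ x₁<top
    x₃<top = <-trans x₃<x₁ x₁<top

module Valuation where

  open import Data.Nat
  open import Data.Nat.Properties
  open import Data.Nat.Divisibility using (_∣_; ∣-trans; ∣⇒≤; _∣?_)
  open import Data.Nat.Primality using (Prime; prime⇒nonZero)
  open import Data.List using (List; []; _∷_; map; filter; applyUpTo; upTo)
  open import Data.List.Properties using (map-upTo; map-applyUpTo)
  open import Data.Nat.ListAction using (sum)
  open import Data.Product using (_,_)
  open import Data.Empty using (⊥-elim)
  open import Function using (_∘_)
  open import Relation.Nullary using (¬_; Dec; yes; no)
  open import Relation.Binary.PropositionalEquality
  open import Defs using (C; bound)
  open Counting
  open import Algebra.Properties.CommutativeSemigroup +-commutativeSemigroup
    using () renaming (interchange to +-interchange)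
  open PrimePowers using (prime>1; split-power; ^-mono-∣)

  sum-map-+ : ∀ {A : Set} (f g : A → ℕ) xs → sum (map (λ x → f x + g x) xs) ≡ sum (map f xs) + sum (map g xs)
  sum-map-+ f g []       = refl
  sum-map-+ f g (x ∷ xs) =
    trans (cong (f x + g x +_) (sum-map-+ f g xs)) (+-interchange (f x) (g x) (sum (map f xs)) (sum (map g xs)))

  sum-map-≤-scaled : ∀ {A : Set} (f g : A → ℕ) c → (∀ x → f x ≤ c * g x) → ∀ xs →
    sum (map f xs) ≤ c * sum (map g xs)
  sum-map-≤-scaled f g c f≤cg []       = z≤n
  sum-map-≤-scaled f g c f≤cg (x ∷ xs) = begin
    f x + sum (map f xs)           ≤⟨ +-mono-≤ (f≤cg x) (sum-map-≤-scaled f g c f≤cg xs) ⟩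
    c * g x + c * sum (map g xs)   ≡⟨ *-distribˡ-+ c (g x) _ ⟨
    c * (g x + sum (map g xs))     ∎
    where open ≤-Reasoning

  sum-filter-≥ : ∀ {A : Set} {Q : A → Set} (Q? : ∀ x → Dec (Q x)) (f g : A → ℕ) →
    (∀ x → g x ≤ f x) → (∀ x → ¬ Q x → g x ≡ 0) → ∀ xs → sum (map g xs) ≤ sum (map f (filter Q? xs))
  sum-filter-≥ Q? f g g≤f g-vanishes []       = z≤n
  sum-filter-≥ Q? f g g≤f g-vanishes (x ∷ xs) with Q? x
  ... | yes _  = +-mono-≤ (g≤f x) (sum-filter-≥ Q? f g g≤f g-vanishes xs)
  ... | no ¬Qx = subst (λ gx → gx + sum (map g xs) ≤ _) (sym (g-vanishes x ¬Qx))
                   (sum-filter-≥ Q? f g g≤f g-vanishes xs)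

  sum-applyUpTo-≥ : ∀ (g : ℕ → ℕ) K t → t ≤ K → (∀ i → i < t → 1 ≤ g i) → t ≤ sum (applyUpTo g K)
  sum-applyUpTo-≥ g K       zero    _       _        = z≤n
  sum-applyUpTo-≥ g (suc K) (suc t) (s≤s t≤K) g-pos =
    +-mono-≤ (g-pos 0 (s≤s z≤n)) (sum-applyUpTo-≥ (g ∘ suc) K t t≤K (λ i i<t → g-pos (suc i) (s≤s i<t)))

  indicator-yes : ∀ {A : Set} (d : Dec A) → A → indicator d ≡ 1
  indicator-yes (yes _) _ = refl
  indicator-yes (no ¬a) a = ⊥-elim (¬a a)

  -- t < p^t for p ≥ 2: an exponent with p^t ≤ N is itself at most N.
  exponent<power : ∀ p → 1 < p → ∀ t → t < p ^ t
  exponent<power p 1<p zero    = s≤s z≤n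
  exponent<power p 1<p (suc t) = ≤-<-trans (exponent<power p 1<p t) (^-monoʳ-< p 1<p (n<1+n t))

  Root : ℕ → ℕ → Set
  Root q k = q ∣ k ^ 3 + 1

  root? : ∀ q k → Dec (Root q k)
  root? q k = q ∣? k ^ 3 + 1

  -- ord_p(C n) is at most Σ_j #{k ≤ n | p^j ∣ k³ + 1}, the sum running over the
  -- exponents j ≥ 1 with p^j ≤ n³ + 1 (larger p^j divide no k³ + 1 with k ≤ n).
  module _ {p} (pr : Prime p) (n : ℕ) where

    private
      instance
        p≢0 : NonZero p
        p≢0 = prime⇒nonZero pr

    exponents : List ℕ
    exponents = filter (λ j → p ^ j ≤? n ^ 3 + 1) (map suc (upTo (n ^ 3 + 1)))

    roots : ℕ → ℕ → ℕ
    roots j m = count (root? (p ^ j)) 1 m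

    -- p^t ∣ k³ + 1 (k ≤ n) gives t ≤ #{j ∈ exponents | p^j ∣ k³ + 1}: all of 1, …, t qualify.
    ord-term : ∀ {k t} → k ≤ n → p ^ t ∣ k ^ 3 + 1 →
      t ≤ sum (map (λ j → indicator (root? (p ^ j) k)) exponents)
    ord-term {k} {t} k≤n pᵗ∣k³+1 = begin
      t                                   ≤⟨ sum-applyUpTo-≥ (atMost ∘ suc) N t t≤N
                                               (λ i i<t → ≤-reflexive (sym (indicator-yes (suc i ≤? t) i<t))) ⟩
      sum (applyUpTo (atMost ∘ suc) N)    ≡⟨ cong sum (trans (cong (map atMost) (map-upTo suc N)) (map-applyUpTo suc atMost N)) ⟨
      sum (map atMost (map suc (upTo N))) ≤⟨ sum-filter-≥ (λ j → p ^ j ≤? N) isRoot atMost atMost≤isRoot atMost-vanishes (map suc (upTo N)) ⟩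
      sum (map isRoot exponents)          ∎
      where
      open ≤-Reasoning
      N = n ^ 3 + 1
      atMost isRoot : ℕ → ℕ
      atMost j = indicator (j ≤? t)
      isRoot j = indicator (root? (p ^ j) k)
      pᵗ≤N : p ^ t ≤ N
      pᵗ≤N = ≤-trans (∣⇒≤ {{>-nonZero (m≤n+m 1 (k ^ 3))}} pᵗ∣k³+1) (+-monoˡ-≤ 1 (^-monoˡ-≤ 3 k≤n))
      t≤N : t ≤ N
      t≤N = ≤-trans (<⇒≤ (exponent<power p (prime>1 pr) t)) pᵗ≤N
      atMost≤isRoot : ∀ j → atMost j ≤ isRoot j
      atMost≤isRoot j with j ≤? t
      ... | no _    = z≤n
      ... | yes j≤t = ≤-reflexive (sym (indicator-yes (root? (p ^ j) k) (∣-trans (^-mono-∣ p j≤t) pᵗ∣k³+1)))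
      atMost-vanishes : ∀ j → ¬ p ^ j ≤ N → atMost j ≡ 0
      atMost-vanishes j pʲ≰N with j ≤? t
      ... | no _    = refl
      ... | yes j≤t = ⊥-elim (pʲ≰N (≤-trans (^-monoʳ-≤ p j≤t) pᵗ≤N))

    ord-product : ∀ {m e} → m ≤ n → p ^ e ∣ C m → e ≤ sum (map (λ j → roots j m) exponents)
    ord-product {zero} {e} _ pᵉ∣1 = ≤-trans (s≤s⁻¹ (≤-trans (exponent<power p (prime>1 pr) e) (∣⇒≤ pᵉ∣1))) z≤n
    ord-product {suc m} {e} m<n pᵉ∣C with split-power pr e (C m) (suc m ^ 3 + 1) pᵉ∣C
    ... | e₁ , e₂ , pᵉ¹∣C , pᵉ²∣term , e≤e₁+e₂ = begin
      e                                              ≤⟨ e≤e₁+e₂ ⟩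
      e₁ + e₂                                        ≤⟨ +-mono-≤ (ord-product {e = e₁} (<⇒≤ m<n) pᵉ¹∣C) (ord-term {t = e₂} m<n pᵉ²∣term) ⟩
      sum (map (λ j → roots j m) exponents) + sum (map isRoot exponents) ≡⟨ sum-map-+ (λ j → roots j m) isRoot exponents ⟨
      sum (map (λ j → roots j (suc m)) exponents)    ∎
      where
      open ≤-Reasoning
      isRoot : ℕ → ℕ
      isRoot j = indicator (root? (p ^ j) (suc m))

    ord-bound : ∀ c → (∀ j → Sparse (Root (p ^ j)) c (p ^ j)) → ∀ {e} → p ^ e ∣ C n → e ≤ c * bound p n
    ord-bound c sparse pᵉ∣C = ≤-trans (ord-product ≤-refl pᵉ∣C)
      (sum-map-≤-scaled _ _ c (λ j → count-sparse (root? (p ^ j)) {{m^n≢0 p j}} (sparse j) 1 n) exponents)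

module Sparseness where

  open import Data.Nat as ℕ using (zero; suc; _≤_; _∸_; _^_; _%_; s≤s; z≤n)
  import Data.Nat.Properties as ℕ
  open import Data.Nat.Divisibility using (1∣_) renaming (_∣_ to _∣ℕ_)
  open import Data.Nat.Primality using (Prime)
  open import Data.Integer using (+_; _+_; _-_; _*_; 1ℤ) renaming (∣_∣ to abs)
  open import Data.Integer.Properties using (pos-+; m-n≡m⊖n; ⊖-≥)
  open import Data.Integer.Divisibility.Signed using (_∣_; ∣ᵤ⇒∣; ∣⇒∣ᵤ; ∣m∣n⇒∣m-n)
  open import Data.Integer.Tactic.RingSolver using (solve-∀)
  open import Data.Product using (_,_)
  open import Relation.Nullary using (¬_)
  open import Relation.Binary.PropositionalEquality
  open Counting
  open CubeRoots
  open Valuation using (Root)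

  root-ℤ : ∀ {q} x → Root q x → + q ∣ + x * + x * + x + 1ℤ
  root-ℤ {q} x root = subst (+ q ∣_) (trans (pos-+ (x ^ 3) 1) (cong (_+ 1ℤ) (trans (pos-^ x 3) (shape (+ x)))))
                          (∣ᵤ⇒∣ root)
    where
    shape : ∀ X → X * (X * (X * 1ℤ)) ≡ X * X * X
    shape = solve-∀

  congruence-ℕ : ∀ {q x y} → y ≤ x → + q ∣ + x - + y → q ∣ℕ x ∸ y
  congruence-ℕ {q} {x} {y} y≤x q∣x-y = subst (q ∣ℕ_) (cong abs (trans (m-n≡m⊖n x y) (⊖-≥ y≤x))) (∣⇒∣ᵤ q∣x-y)

  -- p ≡ 2 (mod 3): all roots modulo p^j are congruent, so at most one per window of length p^j.
  sparse-2-mod-3 : ∀ {p} → Prime p → p % 3 ≡ 2 → ∀ j → Sparse (Root (p ^ j)) 1 (p ^ j)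
  sparse-2-mod-3 {p} pr p%3≡2 j = sparse-mono (ℕ.≤-reflexive (sym (ℕ.*-identityˡ (p ^ j))))
    (sparse-of-congruent (λ {x} {y} rootX rootY y<x →
       congruence-ℕ (ℕ.<⇒≤ y<x) (roots-congruent pr p%3≡2 j x y (root-ℤ x rootX) (root-ℤ y rootY))) 1)

  -- p ≠ 3: no four pairwise incongruent roots modulo p^j, so at most three per window.
  sparse-not-3 : ∀ {p} → Prime p → p ≢ 3 → ∀ j → Sparse (Root (p ^ j)) 3 (p ^ j)
  sparse-not-3 pr p≢3 zero = sparse-of-three-classes (λ _ _ _ _ (_ , 1∤) _ _ _ _ _ → 1∤ (1∣ _))
  sparse-not-3 {p} pr p≢3 (suc j) = sparse-of-three-classes (λ {x₁} {x₂} {x₃} {x₄} r₁ r₂ r₃ r₄ a₁₂ a₁₃ a₁₄ a₂₃ a₂₄ a₃₄ →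
    no-four-roots pr p≢3 j (+ x₁) (+ x₂) (+ x₃) (+ x₄) (root-ℤ x₁ r₁) (root-ℤ x₂ r₂) (root-ℤ x₃ r₃) (root-ℤ x₄ r₄)
      (incongruent a₁₂) (incongruent a₁₃) (incongruent a₁₄) (incongruent a₂₃) (incongruent a₂₄) (incongruent a₃₄))
    where
    incongruent : ∀ {x y} → Apart (p ^ suc j) x y → ¬ + (p ^ suc j) ∣ + x - + y
    incongruent (y<x , q∤x-y) q∣x-y = q∤x-y (congruence-ℕ (ℕ.<⇒≤ y<x) q∣x-y)

  -- p = 3: roots modulo 3^(j+1) are congruent modulo 3^j, so at most three per window of length 3^(j+1).
  sparse-3 : ∀ j → Sparse (Root (3 ^ j)) 3 (3 ^ j)
  sparse-3 zero    = sparse-mono (s≤s z≤n) (sparse-of-congruent {r = 1} (λ _ _ _ → 1∣ _) 3)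
  sparse-3 (suc j) = sparse-of-congruent (λ {x} {y} rootX rootY y<x →
    congruence-ℕ (ℕ.<⇒≤ y<x) (subst (_ ∣_) (identity (+ x) (+ y))
      (∣m∣n⇒∣m-n (root-mod-3 j x (root-ℤ x rootX)) (root-mod-3 j y (root-ℤ y rootY))))) 3
    where
    identity : ∀ X Y → X + 1ℤ - (Y + 1ℤ) ≡ X - Y
    identity = solve-∀

open import Defs
open import Data.Nat using (ℕ; _*_; _≤_; _%_; _≟_)
open import Data.Nat.Properties using (≤-trans; ≤-reflexive; *-identityˡ)
open import Data.Nat.Primality using (Prime)
open import Data.Product using (_×_; _,_)
open import Relation.Nullary using (yes; no)
open import Relation.Binary.PropositionalEquality using (_≡_; _≢_; refl)
open Valuation using (ord-bound)
open Sparseness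

proposition2p10 : (n p : ℕ) → 1 ≤ n → Prime p → (e : ℕ) → IsOrd p (C n) e →
    (p % 3 ≡ 2 → e ≤ bound p n) × (p % 3 ≢ 2 → e ≤ 3 * bound p n)
proposition2p10 n p _ pr e (pᵉ∣C , _) = case-2-mod-3 , case-otherwise
  where
  case-2-mod-3 : p % 3 ≡ 2 → e ≤ bound p n
  case-2-mod-3 p%3≡2 = ≤-trans (ord-bound pr n 1 (sparse-2-mod-3 pr p%3≡2) pᵉ∣C) (≤-reflexive (*-identityˡ _))
  case-otherwise : p % 3 ≢ 2 → e ≤ 3 * bound p n
  case-otherwise _ with p ≟ 3
  ... | yes refl = ord-bound pr n 3 sparse-3 pᵉ∣C
  ... | no p≢3   = ord-bound pr n 3 (sparse-not-3 pr p≢3) pᵉ∣C
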